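{- Let $u$ be a set and let $W:\mathcal{P}(u)\to\mathcal{P}(u)$ be a monotonic and strict set transformer ($W(\varnothing)=\varnothing$). For $r\subseteq u$ let $\mathcal{F}(r):\mathcal{P}(u)\to\mathcal{P}(u)$ be the set transformer $\mathcal{F}(r)(x)=r\cup W(x)$ (the guarded set transformer $\overline{r}\Longrightarrow W$), and let $\mathrm{fix}(\mathcal{F}(r))$ denote its least fixpoint. Define the termination relation $$\mathcal{T}=\{(a,b)\mid a\subseteq u,\ b\subseteq u,\ a\subseteq \mathrm{fix}(\mathcal{F}(b))\}.$$ Let $\mathcal{E}\subseteq\mathcal{P}(u)\times\mathcal{P}(u)$ be a relation, and let $\mathcal{L}\subseteq\mathcal{P}(u)\times\mathcal{P}(u)$ be the reachability relation generated by $\mathcal{E}$, i.e. the smallest relation such that (SBR) $\mathcal{E}\subseteq\mathcal{L}$; (STR) if $(a,c)\in\mathcal{L}$ and $(c,b)\in\mathcal{L}$ then $(a,b)\in\mathcal{L}$; (SDR) for every $q\subseteq u$ and every family $l\subseteq\mathcal{P}(u)$, if $(p,q)\in\mathcal{L}$ for all $p\in l$ then $(\bigcup l,q)\in\mathcal{L}$. Assume that for all $a,b,r\subseteq u$: (a) if $(a,b)\in\mathcal{E}$ then $a\cap\overline{b}\subseteq W(b)$; (b) if $a\subseteq b$ then $(a,b)\in\mathcal{E}$; (c) $(W(r),r)\in\mathcal{L}$. Then $\mathcal{L}=\mathcal{T}$.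
   Context: A set transformer on $u$ is a total function $\mathcal{P}(u)\to\mathcal{P}(u)$. For $p\subseteq u$, $\overline{p}$ denotes $u\setminus p$. Least fixpoints exist by the Knaster–Tarski theorem since $\mathcal{F}(r)$ is monotonic. -}

module Defs where

open import Level using (0ℓ; suc)
open import Data.Product using (Σ; _×_)
open import Relation.Unary using (Pred; _⊆_; _≐_; _∪_; ∅)

Subset : Set → Set₁
Subset U = Pred U 0ℓ

Transformer : Set → Set₁
Transformer U = Subset U → Subset U

SRel : Set → Set₁
SRel U = Subset U → Subset U → Set

Monotonic : {U : Set} → Transformer U → Set₁
Monotonic W = ∀ p q → p ⊆ q → W p ⊆ W q

Strict : {U : Set} → Transformer U → Set
Strict W = W ∅ ≐ ∅

𝓕 : {U : Set} → Transformer U → Subset U → Transformer U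
𝓕 W r x = r ∪ W x

-- Least fixpoint (Knaster–Tarski): intersection of all prefixpoints.
-- It lives one universe up (impredicative intersection).
lfp : {U : Set} → Transformer U → Pred U (suc 0ℓ)
lfp {U} F x = ∀ (p : Subset U) → F p ⊆ p → p x

𝓣 : {U : Set} → Transformer U → Subset U → Subset U → Set₁
𝓣 W a b = a ⊆ lfp (𝓕 W b)

⋃ₗ : {U : Set} → Pred (Subset U) 0ℓ → Pred U (suc 0ℓ)
⋃ₗ {U} l x = Σ (Subset U) (λ p → l p × p x)

IsUnion : {U : Set} → Pred (Subset U) 0ℓ → Subset U → Set₁
IsUnion l a = a ≐ ⋃ₗ l

data Reach {U : Set} (E : SRel U) : Subset U → Subset U → Set₁ where
  sbr : ∀ {a b} → E a b → Reach E a b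
  str : ∀ {a b c} → Reach E a c → Reach E c b → Reach E a b
  sdr : ∀ {q} (l : Pred (Subset U) 0ℓ) (a : Subset U) → IsUnion l a →
        (∀ p → l p → Reach E p q) → Reach E a q

-- Soundness (L ⊆ T) is an induction on derivations: T contains E, because
-- a step out of b stays in b ∪ W(b) ⊆ fix(F(b)); T is transitive, because
-- a ⊆ fix(F(c)) and c ⊆ fix(F(b)) force fix(F(c)) ⊆ fix(F(b)); and T is
-- closed under unions. Completeness (T ⊆ L): the union of all p with
-- (p,b) ∈ L, call it the basin of b, satisfies (basin b, b) ∈ L by (SDR),
-- and it is a prefixpoint of F(b) since b and W(basin b) both reach b.
-- Hence fix(F(b)) ⊆ basin b, and (a,b) ∈ T gives (a, basin b) ∈ E, so
-- (a,b) ∈ L by (STR).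
module Submission where

open import Defs
open import Level using (Level; 0ℓ; suc; Lift; lift)
open import Data.Product using (_×_; _,_)
open import Data.Sum using (inj₁; inj₂)
open import Relation.Unary using (Pred; _⊆_; _∩_; _∪_; ∁)
open import Relation.Nullary using (yes; no)
open import Relation.Nullary.Decidable using (True; toWitness; fromWitness)
open import Axiom.ExcludedMiddle using (ExcludedMiddle)

private
  variable
    ℓ : Level
    U : Set

lfp-least : (F : Transformer U) {p : Subset U} → F p ⊆ p → lfp F ⊆ p
lfp-least F pre x∈lfp = x∈lfp _ pre

lfp-𝓕-mono : (W : Transformer U) {b c : Subset U} →
             c ⊆ lfp (𝓕 W b) → lfp (𝓕 W c) ⊆ lfp (𝓕 W b)
lfp-𝓕-mono W c⊆fix x∈fix p pre =
  x∈fix p λ { (inj₁ x∈c) → c⊆fix x∈c p pre ; (inj₂ x∈Wp) → pre (inj₂ x∈Wp) }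

𝓕-self⊆lfp : (W : Transformer U) → Monotonic W → (b : Subset U) →
             𝓕 W b b ⊆ lfp (𝓕 W b)
𝓕-self⊆lfp W mono b (inj₁ x∈b) p pre = pre (inj₁ x∈b)
𝓕-self⊆lfp W mono b (inj₂ x∈Wb) p pre =
  pre (inj₂ (mono b p (λ y∈b → pre (inj₁ y∈b)) x∈Wb))

∩∁⊆⇒⊆∪ : ExcludedMiddle (suc 0ℓ) → {a b c : Subset U} →
          a ∩ ∁ b ⊆ c → a ⊆ b ∪ c
∩∁⊆⇒⊆∪ em {b = b} a∩∁b⊆c {x} x∈a with em {P = Lift _ (b x)}
... | yes (lift x∈b) = inj₁ x∈b
... | no x∉b = inj₂ (a∩∁b⊆c (x∈a , λ x∈b → x∉b (lift x∈b)))

⊆-⋃ₗ : {l : Pred (Subset U) 0ℓ} {a : Subset U} {t : Pred U ℓ} →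
       IsUnion l a → (∀ p → l p → p ⊆ t) → a ⊆ t
⊆-⋃ₗ (a⊆⋃l , _) p⊆t x∈a with a⊆⋃l x∈a
... | p , lp , x∈p = p⊆t p lp x∈p

𝓣-trans : (W : Transformer U) {a b c : Subset U} →
          𝓣 W a c → 𝓣 W c b → 𝓣 W a b
𝓣-trans W a⊆fixc c⊆fixb x∈a = lfp-𝓕-mono W c⊆fixb (a⊆fixc x∈a)

Reach⇒𝓣 : ExcludedMiddle (suc 0ℓ) → (W : Transformer U) → Monotonic W →
          (E : SRel U) → (∀ a b → E a b → a ∩ ∁ b ⊆ W b) →
          ∀ {a b} → Reach E a b → 𝓣 W a b
Reach⇒𝓣 em W mono E E⇒∩∁⊆W = sound
  where
  sound : ∀ {a b} → Reach E a b → 𝓣 W a b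
  sound {a} {b} (sbr e) x∈a =
    𝓕-self⊆lfp W mono b (∩∁⊆⇒⊆∪ em {c = W b} (E⇒∩∁⊆W a b e) x∈a)
  sound (str a↝c c↝b) = 𝓣-trans W (sound a↝c) (sound c↝b)
  sound (sdr l a a≐⋃l p↝q) = ⊆-⋃ₗ a≐⋃l (λ p lp → sound (p↝q p lp))

-- Reach E p b is large (Set₁); excluded middle turns it into a proposition
-- in Set, so that the sources of b form a family of subsets of U and their
-- union is again a subset of U.
module Basin (em : ExcludedMiddle (suc 0ℓ)) (E : SRel U) (b : Subset U) where

  sources : Pred (Subset U) 0ℓ
  sources p = True (em {P = Reach E p b})

  basin : Subset U
  basin x = True (em {P = ⋃ₗ sources x})

  basin-isUnion : IsUnion sources basin
  basin-isUnion = toWitness , fromWitness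

  basin-reaches : Reach E basin b
  basin-reaches = sdr sources basin basin-isUnion (λ p → toWitness)

  Reach⇒⊆basin : ∀ {p} → Reach E p b → p ⊆ basin
  Reach⇒⊆basin p↝b x∈p = fromWitness (_ , fromWitness p↝b , x∈p)

  basin-prefixpoint : (W : Transformer U) → (∀ r → E r r) →
                      (∀ r → Reach E (W r) r) → 𝓕 W b basin ⊆ basin
  basin-prefixpoint W refl-E W↝ (inj₁ x∈b) = Reach⇒⊆basin (sbr (refl-E b)) x∈b
  basin-prefixpoint W refl-E W↝ (inj₂ x∈W) =
    Reach⇒⊆basin (str (W↝ basin) basin-reaches) x∈W

𝓣⇒Reach : ExcludedMiddle (suc 0ℓ) → (W : Transformer U) → (E : SRel U) →
          (∀ a b → a ⊆ b → E a b) → (∀ r → Reach E (W r) r) →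
          ∀ {a b} → 𝓣 W a b → Reach E a b
𝓣⇒Reach em W E ⊆⇒E W↝ {a} {b} a⊆fix =
  str (sbr (⊆⇒E a basin a⊆basin)) basin-reaches
  where
  open Basin em E b
  a⊆basin : a ⊆ basin
  a⊆basin x∈a = lfp-least (𝓕 W b)
    (basin-prefixpoint W (λ r → ⊆⇒E r r (λ x∈r → x∈r)) W↝) (a⊆fix x∈a)

theorem2 : ExcludedMiddle (suc 0ℓ) →
    {U : Set} (W : Transformer U) → Monotonic W → Strict W →
    (E : SRel U) →
    (∀ a b → E a b → (a ∩ ∁ b) ⊆ W b) →
    (∀ a b → a ⊆ b → E a b) →
    (∀ r → Reach E (W r) r) →
    ∀ a b → (Reach E a b → 𝓣 W a b) × (𝓣 W a b → Reach E a b)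
theorem2 em W mono _ E E⇒∩∁⊆W ⊆⇒E W↝ a b =
  Reach⇒𝓣 em W mono E E⇒∩∁⊆W , 𝓣⇒Reach em W E ⊆⇒E W↝
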